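{- If $T$ is a tree of order $n\geq 3$, then ${\chi^\Sigma_g}^\star(T)\leq 4$.
   Context: For an Abelian group $\mathcal{G}$ with identity $0$ and $f\colon E(T)\to\mathcal{G}$, the weight of $v$ is $w_f(v)=\sum_{u\in N(v)}f(uv)$. The nowhere-zero group sum chromatic number ${\chi^\Sigma_g}^\star(T)$ is the smallest positive integer $k$ such that for every Abelian group $\mathcal{G}$ of order $k$ there exists $f\colon E(T)\to\mathcal{G}\setminus\{0\}$ with $w_f(u)\neq w_f(v)$ for every edge $uv$. -}

module Defs where

open import Level using (0ℓ)
open import Data.Nat using (ℕ; zero; suc; _+_; _≤_)
open import Data.Fin using (Fin; zero; suc; inject₁; fromℕ)
open import Data.Bool using (Bool; true; false; T; if_then_else_)
open import Data.List using (List; foldr; allFin)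
open import Data.Product using (Σ; ∃; ∃-syntax; _×_; _,_)
open import Relation.Nullary using (¬_)
open import Relation.Binary.PropositionalEquality using (_≡_; _≢_)
import Relation.Binary.PropositionalEquality as ≡
open import Function.Bundles using (Inverse)
open import Function.Definitions using (Injective)
open import Algebra.Bundles using (AbelianGroup)

record SimpleGraph (n : ℕ) : Set where
  field
    adj    : Fin n → Fin n → Bool
    sym    : ∀ u v → adj u v ≡ adj v u
    irrefl : ∀ v → adj v v ≡ false

  Adj : Fin n → Fin n → Set
  Adj u v = T (adj u v)

open SimpleGraph public

data Walk {n : ℕ} (G : SimpleGraph n) : Fin n → Fin n → Set where
  nil  : ∀ {v} → Walk G v v
  cons : ∀ {u w v} → Adj G u w → Walk G w v → Walk G u v

Connected : ∀ {n} → SimpleGraph n → Set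
Connected G = ∀ u v → Walk G u v

HasCycle : ∀ {n} → SimpleGraph n → Set
HasCycle {n} G =
  ∃[ k ] Σ (Fin (suc (suc (suc k))) → Fin n) λ c →
    Injective _≡_ _≡_ c
    × (∀ (i : Fin (suc (suc k))) → Adj G (c (inject₁ i)) (c (suc i)))
    × Adj G (c (fromℕ (suc (suc k)))) (c zero)

IsTree : ∀ {n} → SimpleGraph n → Set
IsTree G = Connected G × ¬ HasCycle G

module _ (A : AbelianGroup 0ℓ 0ℓ) where
  open AbelianGroup A

  HasOrder : ℕ → Set
  HasOrder k = Inverse setoid (≡.setoid (Fin k))

  weight : ∀ {n} → SimpleGraph n → (Fin n → Fin n → Carrier) → Fin n → Carrier
  weight {n} G f v =
    foldr (λ u acc → (if adj G u v then f u v else ε) ∙ acc) ε (allFin n)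

  GoodLabelling : ∀ {n} → SimpleGraph n → (Fin n → Fin n → Carrier) → Set
  GoodLabelling {n} G f =
    (∀ u v → Adj G u v → f u v ≈ f v u)
    × (∀ u v → Adj G u v → ¬ (f u v ≈ ε))
    × (∀ u v → Adj G u v → ¬ (weight G f u ≈ weight G f v))

GroupSumColourable : ∀ {n} → SimpleGraph n → ℕ → Set₁
GroupSumColourable G k =
  ∀ (A : AbelianGroup 0ℓ 0ℓ) → HasOrder A k →
    Σ (Fin _ → Fin _ → AbelianGroup.Carrier A) λ f → GoodLabelling A G f

-- χ^Σ_g*(G) ≤ m : the least positive k with the property is ≤ m,
-- i.e. some k with 1 ≤ k ≤ m has the property.
NZGroupSumChromatic≤ : ∀ {n} → SimpleGraph n → ℕ → Set₁
NZGroupSumChromatic≤ G m = ∃[ k ] (1 ≤ k × k ≤ m × GroupSumColourable G k)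

module Submission where

-- Root the tree at r, fix a neighbour c₀ of r and a nonzero e, and label the edges top-down.
-- When a vertex w is reached, the label a of the edge above it and the weight b of its parent
-- are known (for r: the edge r c₀, labelled e, and b = e). One child of w gets a label x, its
-- k other children (c₀ excluded) get g, so that w gets weight s = a + x + k g. In an abelian
-- group with at least four elements one finds g ≠ 0 with T = a + k g ≠ 0, and then
-- x ∉ {0, b - T, g - T}; hence s ≠ b, s ≠ g and s ≠ x. So w differs from its parent whenever
-- w has children, and from each leaf child, whose weight is its label g or x.
-- The leaf c₀ has weight e, which differs from the weight of r by the choice b = e, unless r
-- has no other child; then c₀ has children, as the tree has at least three vertices.

open import Level using (0ℓ; _⊔_)
open import Data.Nat using (ℕ; zero; suc; _+_; _<_; _≤_; s≤s; z≤n)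
open import Data.Nat.Properties as ℕₚ using (anyUpTo?; ≮⇒≥; ≤-antisym; ≤-refl; <⇒≤; n≤0⇒n≡0)
open import Data.Nat.Induction using (<-rec)
open import Data.Fin using (Fin; zero; suc; inject₁; fromℕ)
open import Data.Fin.Properties using (any?; <⇒notInjective; suc-injective; punchInᵢ≢i) renaming (_≟_ to _≟ᶠ_)
open import Data.Empty using (⊥; ⊥-elim)
open import Data.Bool using (T; true; false; if_then_else_)
open import Data.Unit using (tt)
open import Data.List using (foldr; tabulate)
open import Data.Sum using (_⊎_; inj₁; inj₂; [_,_]′)
open import Data.Product as Product using (Σ; ∃; ∃₂; _×_; _,_; proj₁; proj₂)
open import Function using (id; _∘_; Inverse)
open import Function.Definitions using (Injective)
open import Relation.Nullary using (¬_; Dec; yes; no; ¬?; contradiction; _×-dec_; _⊎-dec_)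
open import Relation.Nullary.Decidable using (decidable-stable; map′; T?)
open import Relation.Binary using (Setoid; Decidable)
import Relation.Unary as U
open import Relation.Binary.PropositionalEquality as ≡ using (_≡_; _≢_)
open import Algebra.Bundles using (AbelianGroup; CommutativeMonoid)
open import Defs hiding (sym)

Fin-avoid : ∀ {m n} → m < n → (xs : Fin m → Fin n) → ∃ λ i → ∀ j → xs j ≢ i
Fin-avoid m<n xs with any? (λ i → ¬? (any? λ j → xs j ≟ᶠ i))
... | yes (i , i∉xs) = i , λ j xsj≡i → i∉xs (j , xsj≡i)
... | no ¬avoid = ⊥-elim (<⇒notInjective m<n preimage-injective)
  where
  covered : ∀ i → ∃ λ j → xs j ≡ i
  covered i = decidable-stable (any? λ j → xs j ≟ᶠ i) (λ i∉xs → ¬avoid (i , i∉xs))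

  preimage-injective : Injective _≡_ _≡_ (proj₁ ∘ covered)
  preimage-injective {i} {j} same =
    ≡.trans (≡.sym (proj₂ (covered i))) (≡.trans (≡.cong xs same) (proj₂ (covered j)))

count : ∀ {n p} {P : U.Pred (Fin n) p} → U.Decidable P → ℕ
count {zero}  P? = 0
count {suc n} P? with P? zero
... | yes _ = suc (count (P? ∘ suc))
... | no  _ = count (P? ∘ suc)

Least : ∀ {p} → (ℕ → Set p) → ℕ → Set p
Least P m = P m × (∀ {i} → i < m → ¬ P i)

least : ∀ {p} {P : ℕ → Set p} → U.Decidable P → ∀ {j} → P j → ∃ (Least P)
least {P = P} P? {j} = <-rec (λ j → P j → ∃ (Least P)) search j
  where
  search : ∀ j → (∀ {i} → i < j → P i → ∃ (Least P)) → P j → ∃ (Least P)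
  search j smaller pj with anyUpTo? P? j
  ... | yes (i , i<j , pi) = smaller i<j pi
  ... | no none = j , pj , λ i<j pi → none (_ , i<j , pi)

module _ {c ℓ} (S : Setoid c ℓ) {n} (enum : Inverse S (≡.setoid (Fin n))) where
  open Setoid S
  open Inverse enum

  enumerated-≟ : Decidable _≈_
  enumerated-≟ x y =
    map′ (λ e → trans (sym (strictlyInverseʳ x)) (trans (reflexive (≡.cong from e)) (strictlyInverseʳ y)))
         to-cong (to x ≟ᶠ to y)

  enumerated-avoid : ∀ {m} → m < n → (xs : Fin m → Carrier) → ∃ λ y → ∀ j → y ≉ xs j
  enumerated-avoid m<n xs with Fin-avoid m<n (to ∘ xs)
  ... | i , i∉xs = from i , λ j y≈xsj → i∉xs j (≡.trans (≡.sym (to-cong y≈xsj)) (strictlyInverseˡ i))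

record DecidableAtLeast4 {c ℓ} (A : AbelianGroup c ℓ) : Set (c ⊔ ℓ) where
  open AbelianGroup A
  field
    _≟_    : Decidable _≈_
    avoid3 : ∀ a b c → ∃ λ y → y ≉ a × y ≉ b × y ≉ c

enumerated⇒decidableAtLeast4 : ∀ {c ℓ} (A : AbelianGroup c ℓ) {n} →
  Inverse (AbelianGroup.setoid A) (≡.setoid (Fin n)) → 3 < n → DecidableAtLeast4 A
enumerated⇒decidableAtLeast4 A enum 3<n = record
  { _≟_    = enumerated-≟ setoid enum
  ; avoid3 = avoid3
  }
  where
  open AbelianGroup A

  avoid3 : ∀ a b c → ∃ λ y → y ≉ a × y ≉ b × y ≉ c
  avoid3 a b c with enumerated-avoid setoid enum 3<n (λ { zero → a ; (suc zero) → b ; (suc (suc zero)) → c })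
  ... | y , y∉ = y , y∉ zero , y∉ (suc zero) , y∉ (suc (suc zero))

module Sums {c ℓ} (M : CommutativeMonoid c ℓ) where
  open CommutativeMonoid M
  open import Algebra.Properties.CommutativeMonoid.Sum M using (sum; sum-remove; sum-cong-≋; sum-replicate-zero)
  open import Algebra.Properties.Monoid.Mult monoid using () renaming (_×_ to _·_)

  when : ∀ {p} {P : Set p} → Dec P → Carrier → Carrier
  when (yes _) x = x
  when (no  _) x = ε

  when-yes : ∀ {p} {P : Set p} (P? : Dec P) {x} → P → when P? x ≡ x
  when-yes (yes _) _  = ≡.refl
  when-yes (no ¬p) p = contradiction p ¬p

  when-no : ∀ {p} {P : Set p} (P? : Dec P) {x} → ¬ P → when P? x ≡ ε
  when-no (yes p) ¬p = contradiction p ¬p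
  when-no (no _)  _  = ≡.refl

  when-congʳ : ∀ {p} {P : Set p} (P? : Dec P) {x y} → (P → x ≈ y) → when P? x ≈ when P? y
  when-congʳ (yes p) x≈y = x≈y p
  when-congʳ (no _)  _   = refl

  when-split : ∀ {p q} {P : Set p} {Q : Set q} (P? : Dec P) (Q? : Dec Q) {x} →
               when P? x ≈ when (P? ×-dec Q?) x ∙ when (P? ×-dec ¬? Q?) x
  when-split (yes _) (yes _) = sym (identityʳ _)
  when-split (yes _) (no _)  = sym (identityˡ _)
  when-split (no _)  _       = sym (identityˡ _)

  sum-zero : ∀ {n} (t : Fin n → Carrier) → (∀ i → t i ≈ ε) → sum t ≈ ε
  sum-zero {n} t t≈ε = trans (sum-cong-≋ t≈ε) (sum-replicate-zero n)

  sum-single : ∀ {n} (t : Fin n → Carrier) q → (∀ i → i ≢ q → t i ≈ ε) → sum t ≈ t q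
  sum-single {suc n} t q t≈ε =
    trans (sum-remove t) (trans (∙-congˡ (sum-zero _ λ i → t≈ε _ (punchInᵢ≢i q i))) (identityʳ (t q)))

  sum-when-count : ∀ {n p} {P : U.Pred (Fin n) p} (P? : U.Decidable P) x →
                   sum (λ i → when (P? i) x) ≈ count P? · x
  sum-when-count {zero}  P? x = refl
  sum-when-count {suc n} P? x with P? zero
  ... | yes _ = ∙-congˡ (sum-when-count (P? ∘ suc) x)
  ... | no  _ = trans (identityˡ _) (sum-when-count (P? ∘ suc) x)

module ChildLabels {c ℓ} (A : AbelianGroup c ℓ) (D : DecidableAtLeast4 A) where
  open AbelianGroup A
  open DecidableAtLeast4 D

  open import Algebra.Properties.AbelianGroup A using (identityʳ-unique; inverseʳ-unique; x≈z//y)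
  open import Algebra.Properties.CommutativeSemigroup commutativeSemigroup using (x∙yz≈y∙xz)
  open import Algebra.Properties.CommutativeMonoid.Mult commutativeMonoid using (×-distrib-+) renaming (_×_ to _·_)
  open import Relation.Binary.Reasoning.Setoid setoid

  -- Among g, p and g ∙ p one works: if none did, then k · p ≈ ε and hence a ≈ ε.
  ∃-g≉ε×a∙k·g≉ε : ∀ {a} → a ≉ ε → ∀ k → ∃ λ g → g ≉ ε × a ∙ k · g ≉ ε
  ∃-g≉ε×a∙k·g≉ε {a} a≉ε k with avoid3 ε ε ε
  ... | g , g≉ε , _ with avoid3 ε (g ⁻¹) ε
  ... | p , p≉ε , p≉g⁻¹ , _ with (a ∙ k · g) ≟ ε | (a ∙ k · p) ≟ ε | (a ∙ k · (g ∙ p)) ≟ ε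
  ... | no ≉ε | _ | _ = g , g≉ε , ≉ε
  ... | yes _ | no ≉ε | _ = p , p≉ε , ≉ε
  ... | yes _ | yes _ | no ≉ε = g ∙ p , (λ gp≈ε → p≉g⁻¹ (inverseʳ-unique g p gp≈ε)) , ≉ε
  ... | yes kg | yes kp | yes kgp = contradiction a≈ε a≉ε
    where
    k·p≈ε : k · p ≈ ε
    k·p≈ε = identityʳ-unique (a ∙ k · g) (k · p) (begin
      (a ∙ k · g) ∙ k · p ≈⟨ assoc _ _ _ ⟩
      a ∙ (k · g ∙ k · p) ≈⟨ ∙-congˡ (×-distrib-+ g p k) ⟨
      a ∙ k · (g ∙ p)     ≈⟨ kgp ⟩
      ε                   ≈⟨ kg ⟨
      a ∙ k · g           ∎)

    a≈ε : a ≈ ε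
    a≈ε = begin
      a         ≈⟨ identityʳ a ⟨
      a ∙ ε     ≈⟨ ∙-congˡ k·p≈ε ⟨
      a ∙ k · p ≈⟨ kp ⟩
      ε         ∎

  -- a: label of the edge above a vertex, b: weight of its parent; one child is labelled x and
  -- k children are labelled g.
  record GoodChildLabels (a b : Carrier) (k : ℕ) (g x : Carrier) : Set ℓ where
    field
      g≉ε : g ≉ ε
      x≉ε : x ≉ ε
      weight≉b : a ∙ (x ∙ k · g) ≉ b
      weight≉g : a ∙ (x ∙ k · g) ≉ g
      weight≉x : a ∙ (x ∙ k · g) ≉ x

  -- The weight is x ∙ T with T = a ∙ k · g ≉ ε, so x only has to avoid ε, b - T and g - T.
  ∃-goodChildLabels : ∀ {a} → a ≉ ε → ∀ b k → ∃₂ (GoodChildLabels a b k)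
  ∃-goodChildLabels {a} a≉ε b k =
    let g , g≉ε , T≉ε = ∃-g≉ε×a∙k·g≉ε a≉ε k
        T : Carrier
        T = a ∙ k · g
        x , x≉ε , x≉b-T , x≉g-T = avoid3 ε (b - T) (g - T)
        s≈x∙T : a ∙ (x ∙ k · g) ≈ x ∙ T
        s≈x∙T = x∙yz≈y∙xz a x (k · g)
    in g , x , record
         { g≉ε      = g≉ε
         ; x≉ε      = x≉ε
         ; weight≉b = λ s≈b → x≉b-T (x≈z//y x T b (trans (sym s≈x∙T) s≈b))
         ; weight≉g = λ s≈g → x≉g-T (x≈z//y x T g (trans (sym s≈x∙T) s≈g))
         ; weight≉x = λ s≈x → T≉ε (identityʳ-unique x T (trans (sym s≈x∙T) s≈x))
         }

module Paths {n} (R : Fin n → Fin n → Set) where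

  infixr 5 _∷_

  data Path : Fin n → Fin n → ℕ → Set where
    []  : ∀ {x} → Path x x 0
    _∷_ : ∀ {x y z m} → R x y → Path y z m → Path x z (suc m)

  vertex : ∀ {x y m} → Path x y m → Fin (suc m) → Fin n
  vertex {x} []      _       = x
  vertex {x} (_ ∷ p) zero    = x
  vertex     (_ ∷ p) (suc i) = vertex p i

  vertex-head : ∀ {x y m} (p : Path x y m) → vertex p zero ≡ x
  vertex-head []      = ≡.refl
  vertex-head (_ ∷ _) = ≡.refl

  vertex-last : ∀ {x y m} (p : Path x y m) → vertex p (fromℕ m) ≡ y
  vertex-last []      = ≡.refl
  vertex-last (_ ∷ p) = vertex-last p

  vertex-step : ∀ {x y m} (p : Path x y m) (i : Fin m) → R (vertex p (inject₁ i)) (vertex p (suc i))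
  vertex-step (e ∷ p) zero    = ≡.subst (R _) (≡.sym (vertex-head p)) e
  vertex-step (e ∷ p) (suc i) = vertex-step p i

  _++_ : ∀ {x y z m k} → Path x y m → Path y z k → Path x z (m + k)
  []      ++ q = q
  (e ∷ p) ++ q = e ∷ (p ++ q)

  _∷ʳ_ : ∀ {x y z m} → Path x y m → R y z → Path x z (suc m)
  []      ∷ʳ e = e ∷ []
  (e′ ∷ p) ∷ʳ e = e′ ∷ (p ∷ʳ e)

  reverse : (∀ {x y} → R x y → R y x) → ∀ {x y m} → Path x y m → Path y x m
  reverse R-sym []      = []
  reverse R-sym (e ∷ p) = reverse R-sym p ∷ʳ R-sym e

  Simple : ∀ {x y m} → Path x y m → Set
  Simple p = Injective _≡_ _≡_ (vertex p)

  drop-simple : ∀ {x y m} (p : Path x y m) → Simple p → (j : Fin (suc m)) →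
                ∃ λ m′ → Σ (Path (vertex p j) y m′) Simple
  drop-simple []      simple zero    = _ , [] , simple
  drop-simple (e ∷ p) simple zero    = _ , e ∷ p , simple
  drop-simple (e ∷ p) simple (suc j) = drop-simple p (λ same → suc-injective (simple same)) j

  simplify : ∀ {x y m} → Path x y m → ∃ λ m′ → Σ (Path x y m′) Simple
  simplify [] = _ , [] , λ { {zero} {zero} _ → ≡.refl }
  simplify {x} (e ∷ p) with simplify p
  ... | m , q , simple with any? (λ j → vertex q j ≟ᶠ x)
  ...   | yes (j , qj≡x) = ≡.subst (λ z → ∃ λ m′ → Σ (Path z _ m′) Simple) qj≡x (drop-simple q simple j)
  ...   | no x∉q = suc m , e ∷ q , simple′
    where
    simple′ : Simple (e ∷ q)
    simple′ {zero}  {zero}  _    = ≡.refl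
    simple′ {zero}  {suc j} same = contradiction (j , ≡.sym same) x∉q
    simple′ {suc i} {zero}  same = contradiction (i , same) x∉q
    simple′ {suc i} {suc j} same = ≡.cong suc (simple same)

module _ {n} (G : SimpleGraph n) where

  Adj-sym : ∀ {u v} → Adj G u v → Adj G v u
  Adj-sym {u} {v} = ≡.subst T (SimpleGraph.sym G u v)

  Adj-irrefl : ∀ {v} → ¬ Adj G v v
  Adj-irrefl {v} = ≡.subst T (irrefl G v)

  exit-edge : ∀ {p} {S : U.Pred (Fin n) p} → U.Decidable S → ∀ {x w} → S x → ¬ S w → Walk G x w →
              ∃₂ λ y z → S y × ¬ S z × Adj G y z
  exit-edge S? sx ¬sw nil = contradiction sx ¬sw
  exit-edge S? sx ¬sw (cons {w = y} a walk) with S? y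
  ... | yes sy  = exit-edge S? sy ¬sw walk
  ... | no  ¬sy = _ , y , sx , ¬sy , a

record ParentPointers {n} (G : SimpleGraph n) (r : Fin n) : Set where
  field
    parent       : Fin n → Fin n
    depth        : Fin n → ℕ
    depth-root   : depth r ≡ 0
    depth-parent : ∀ {v} → v ≢ r → depth v ≡ suc (depth (parent v))
    parent-adj   : ∀ {v} → v ≢ r → Adj G (parent v) v

  _ChildOf_ : Fin n → Fin n → Set
  u ChildOf v = u ≢ r × parent u ≡ v

  _childOf?_ : ∀ u v → Dec (u ChildOf v)
  u childOf? v = ¬? (u ≟ᶠ r) ×-dec (parent u ≟ᶠ v)

  child-adj : ∀ {u v} → u ChildOf v → Adj G u v
  child-adj (u≢r , ≡.refl) = Adj-sym G (parent-adj u≢r)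

  parent-not-child : ∀ {v} → v ≢ r → ¬ parent v ChildOf v
  parent-not-child {v} v≢r (pv≢r , ppv≡v) = m≢2+m (≡.trans (depth-parent v≢r) (≡.cong suc depth-pv))
    where
    depth-pv : depth (parent v) ≡ suc (depth v)
    depth-pv = ≡.subst (λ w → depth (parent v) ≡ suc (depth w)) ppv≡v (depth-parent pv≢r)
    m≢2+m : ∀ {m} → m ≢ suc (suc m)
    m≢2+m ()

  child-asym : ∀ {u v} → u ChildOf v → ¬ v ChildOf u
  child-asym (u≢r , ≡.refl) = parent-not-child u≢r

module BreadthFirst {n} (G : SimpleGraph n) (connected : Connected G) (r : Fin n) where

  ReachableWithin : ℕ → Fin n → Set
  ReachableWithin zero    v = v ≡ r
  ReachableWithin (suc k) v = ReachableWithin k v ⊎ ∃ λ u → ReachableWithin k u × Adj G u v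

  reachableWithin? : ∀ k v → Dec (ReachableWithin k v)
  reachableWithin? zero    v = v ≟ᶠ r
  reachableWithin? (suc k) v =
    reachableWithin? k v ⊎-dec any? (λ u → reachableWithin? k u ×-dec T? (adj G u v))

  walk-reachable : ∀ {k x v} → ReachableWithin k x → Walk G x v → ∃ λ j → ReachableWithin j v
  walk-reachable reach nil        = _ , reach
  walk-reachable reach (cons a w) = walk-reachable (inj₂ (_ , reach , a)) w

  least-reach : ∀ v → ∃ (Least (λ k → ReachableWithin k v))
  least-reach v = least (λ k → reachableWithin? k v) (proj₂ (walk-reachable {0} ≡.refl (connected r v)))

  depth : Fin n → ℕ
  depth v = proj₁ (least-reach v)

  depth-minimal : ∀ {k v} → ReachableWithin k v → depth v ≤ k
  depth-minimal {k} {v} reach = ≮⇒≥ λ k<depth → proj₂ (proj₂ (least-reach v)) k<depth reach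

  depth-root : depth r ≡ 0
  depth-root = n≤0⇒n≡0 (depth-minimal ≡.refl)

  ∃-parent : ∀ {v} → v ≢ r → ∃ λ u → Adj G u v × depth v ≡ suc (depth u)
  ∃-parent {v} v≢r = step (depth v) (proj₁ (proj₂ (least-reach v))) (proj₂ (proj₂ (least-reach v)))
    where
    step : ∀ m → ReachableWithin m v → (∀ {i} → i < m → ¬ ReachableWithin i v) →
           ∃ λ u → Adj G u v × m ≡ suc (depth u)
    step zero    v≡r        _       = contradiction v≡r v≢r
    step (suc k) (inj₁ rk)  minimal = contradiction rk (minimal ≤-refl)
    step (suc k) (inj₂ (u , ru , a)) minimal =
      u , a , ≡.cong suc (≤-antisym (≮⇒≥ shorter) (depth-minimal ru))
      where
      shorter : depth u < k → ⊥
      shorter du<k = minimal (s≤s du<k) (inj₂ (u , proj₁ (proj₂ (least-reach u)) , a))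

  parent : Fin n → Fin n
  parent v with v ≟ᶠ r
  ... | yes _   = r
  ... | no v≢r = proj₁ (∃-parent v≢r)

  parent-spec : ∀ {v} → v ≢ r → Adj G (parent v) v × depth v ≡ suc (depth (parent v))
  parent-spec {v} v≢r with v ≟ᶠ r
  ... | yes v≡r  = contradiction v≡r v≢r
  ... | no v≢r′ = proj₂ (∃-parent v≢r′)

  pointers : ParentPointers G r
  pointers = record
    { parent       = parent
    ; depth        = depth
    ; depth-root   = depth-root
    ; depth-parent = proj₂ ∘ parent-spec
    ; parent-adj   = proj₁ ∘ parent-spec
    }

module _ {n} {G : SimpleGraph n} (acyclic : ¬ HasCycle G) {r} (P : ParentPointers G r) where
  open ParentPointers P

  private
    -- An edge that is not a parent edge closes a cycle with the two paths to the root.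
    module NonTreeEdge {u v} (a : Adj G u v) (¬vu : ¬ v ChildOf u) (¬uv : ¬ u ChildOf v) where

      OtherEdge : Fin n → Fin n → Set
      OtherEdge x y = Adj G x y × ¬ (x ≡ u × y ≡ v) × ¬ (x ≡ v × y ≡ u)

      otherEdge-sym : ∀ {x y} → OtherEdge x y → OtherEdge y x
      otherEdge-sym (a′ , ¬uv′ , ¬vu′) =
        Adj-sym G a′ , (λ (y≡u , x≡v) → ¬vu′ (x≡v , y≡u)) , (λ (y≡v , x≡u) → ¬uv′ (x≡u , y≡v))

      open Paths OtherEdge

      path-to-root : ∀ k x → depth x ≡ k → ∃ (Path x r)
      path-to-root k x dx with x ≟ᶠ r
      path-to-root k       x dx | yes ≡.refl = _ , []
      path-to-root zero    x dx | no x≢r = contradiction (≡.trans (≡.sym (depth-parent x≢r)) dx) λ ()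
      path-to-root (suc k) x dx | no x≢r =
        Product.map suc (up ∷_) (path-to-root k (parent x) (ℕₚ.suc-injective depth-x))
        where
        up : OtherEdge x (parent x)
        up = Adj-sym G (parent-adj x≢r)
           , (λ { (≡.refl , pu≡v) → ¬uv (x≢r , pu≡v) })
           , (λ { (≡.refl , pv≡u) → ¬vu (x≢r , pv≡u) })

        depth-x : suc (depth (parent x)) ≡ suc k
        depth-x = ≡.trans (≡.sym (depth-parent x≢r)) dx

      no-simple-path : ∀ {x y m} (p : Path x y m) → x ≡ u → y ≡ v → Simple p → ⊥
      no-simple-path []             ≡.refl ≡.refl _ = Adj-irrefl G a
      no-simple-path (e ∷ [])       ≡.refl ≡.refl _ = proj₁ (proj₂ e) (≡.refl , ≡.refl)
      no-simple-path p@(_ ∷ _ ∷ _) ≡.refl ≡.refl simple =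
        acyclic (_ , vertex p , simple , proj₁ ∘ vertex-step p , closing)
        where
        closing : Adj G (vertex p (fromℕ _)) u
        closing = ≡.subst (λ y → Adj G y u) (≡.sym (vertex-last p)) (Adj-sym G a)

      absurd : ⊥
      absurd =
        let _ , up-u      = path-to-root _ u ≡.refl
            _ , up-v      = path-to-root _ v ≡.refl
            _ , p , simple = simplify (up-u ++ reverse otherEdge-sym up-v)
        in no-simple-path p ≡.refl ≡.refl simple

  acyclic⇒parent-edge : ∀ {u v} → Adj G u v → v ChildOf u ⊎ u ChildOf v
  acyclic⇒parent-edge {u} {v} a with v childOf? u | u childOf? v
  ... | yes vu | _      = inj₁ vu
  ... | no _   | yes uv = inj₂ uv
  ... | no ¬vu | no ¬uv = ⊥-elim (NonTreeEdge.absurd a ¬vu ¬uv)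

record RootedTree {n} (G : SimpleGraph n) (r : Fin n) : Set where
  field
    pointers : ParentPointers G r
  open ParentPointers pointers public
  field
    parent-edge : ∀ {u v} → Adj G u v → v ChildOf u ⊎ u ChildOf v

tree⇒rootedTree : ∀ {n} {G : SimpleGraph n} → IsTree G → (r : Fin n) → RootedTree G r
tree⇒rootedTree {G = G} (connected , acyclic) r = record
  { pointers    = BreadthFirst.pointers G connected r
  ; parent-edge = acyclic⇒parent-edge acyclic (BreadthFirst.pointers G connected r)
  }

record RootEdge {n} {G : SimpleGraph n} {r} (R : RootedTree G r) : Set where
  open RootedTree R
  field
    c₀          : Fin n
    c₀-child    : c₀ ChildOf r
    beyond-edge : (∃ λ u → u ChildOf r × u ≢ c₀) ⊎ (∃ λ u → u ChildOf c₀)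

module _ {n} {G : SimpleGraph n} (connected : Connected G) {r} (R : RootedTree G r) where
  open RootedTree R

  root-neighbour-child : ∀ {v} → Adj G r v → v ChildOf r
  root-neighbour-child a = [ id , (λ rv → contradiction ≡.refl (proj₁ rv)) ]′ (parent-edge a)

  ∃-root-child : 1 < n → ∃ (_ChildOf r)
  ∃-root-child 1<n with Fin-avoid 1<n (λ _ → r)
  ... | w , r≢w with exit-edge G (_≟ᶠ r) ≡.refl (r≢w zero ∘ ≡.sym) (connected r w)
  ... | _ , c , ≡.refl , _ , a = c , root-neighbour-child a

  sibling-or-grandchild : ∀ {c₀} → c₀ ChildOf r → 2 < n →
                          (∃ λ u → u ChildOf r × u ≢ c₀) ⊎ (∃ λ u → u ChildOf c₀)
  sibling-or-grandchild {c₀} c₀-child 2<n with Fin-avoid 2<n (λ { zero → r ; (suc zero) → c₀ })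
  ... | w , w∉ with exit-edge G (λ v → (v ≟ᶠ r) ⊎-dec (v ≟ᶠ c₀)) (inj₁ ≡.refl) w∉r,c₀ (connected r w)
    where
    w∉r,c₀ : ¬ (w ≡ r ⊎ w ≡ c₀)
    w∉r,c₀ (inj₁ w≡r)  = w∉ zero (≡.sym w≡r)
    w∉r,c₀ (inj₂ w≡c₀) = w∉ (suc zero) (≡.sym w≡c₀)
  ... | _ , z , inj₁ ≡.refl , z∉ , a = inj₁ (z , root-neighbour-child a , z∉ ∘ inj₂)
  ... | _ , z , inj₂ ≡.refl , z∉ , a = inj₂ (z , [ id , (λ c₀z → contradiction (z≡r c₀z) (z∉ ∘ inj₁)) ]′ (parent-edge a))
    where
    z≡r : c₀ ChildOf z → z ≡ r
    z≡r c₀z = ≡.trans (≡.sym (proj₂ c₀z)) (proj₂ c₀-child)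

  rootEdge : 2 < n → RootEdge R
  rootEdge 2<n = record
    { c₀          = proj₁ root-child
    ; c₀-child    = proj₂ root-child
    ; beyond-edge = sibling-or-grandchild (proj₂ root-child) 2<n
    }
    where
    root-child : ∃ (_ChildOf r)
    root-child = ∃-root-child (<⇒≤ 2<n)

module _ (A : AbelianGroup 0ℓ 0ℓ) where
  open AbelianGroup A
  open import Algebra.Properties.CommutativeMonoid.Sum commutativeMonoid using (sum)

  foldr-tabulate : ∀ {m} {X : Set} (F : X → Carrier) (h : Fin m → X) →
                   foldr (λ u acc → F u ∙ acc) ε (tabulate h) ≡ sum (F ∘ h)
  foldr-tabulate {zero}  F h = ≡.refl
  foldr-tabulate {suc m} F h = ≡.cong (F (h zero) ∙_) (foldr-tabulate F (h ∘ suc))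

  weight≡sum : ∀ {n} (G : SimpleGraph n) f v → weight A G f v ≡ sum (λ u → if adj G u v then f u v else ε)
  weight≡sum {n} G f v = foldr-tabulate (λ u → if adj G u v then f u v else ε) id

module TreeWeights (A : AbelianGroup 0ℓ 0ℓ) {n} {G : SimpleGraph n} {r}
  (R : RootedTree G r) (label : Fin n → AbelianGroup.Carrier A) where

  open AbelianGroup A
  open RootedTree R
  open Sums commutativeMonoid
  open import Algebra.Properties.CommutativeMonoid.Sum commutativeMonoid using (sum; ∑-distrib-+; sum-cong-≋)
  open import Relation.Binary.Reasoning.Setoid setoid

  edgeLabel : Fin n → Fin n → Carrier
  edgeLabel u v with u childOf? v
  ... | yes _ = label u
  ... | no  _ = label v

  edgeLabel-child : ∀ {u v} → u ChildOf v → edgeLabel u v ≡ label u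
  edgeLabel-child {u} {v} uv with u childOf? v
  ... | yes _  = ≡.refl
  ... | no ¬uv = contradiction uv ¬uv

  edgeLabel-parent : ∀ {u v} → v ChildOf u → edgeLabel u v ≡ label v
  edgeLabel-parent {u} {v} vu with u childOf? v
  ... | yes uv = contradiction uv (child-asym vu)
  ... | no  _  = ≡.refl

  edgeLabel-sym : ∀ {u v} → Adj G u v → edgeLabel u v ≡ edgeLabel v u
  edgeLabel-sym a with parent-edge a
  ... | inj₁ vu = ≡.trans (edgeLabel-parent vu) (≡.sym (edgeLabel-child vu))
  ... | inj₂ uv = ≡.trans (edgeLabel-child uv) (≡.sym (edgeLabel-parent uv))

  parentSum childSum : Fin n → Carrier
  parentSum v = sum (λ u → when (v childOf? u) (label v))
  childSum  v = sum (λ u → when (u childOf? v) (label u))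

  weight-term : ∀ v u → (if adj G u v then edgeLabel u v else ε) ≈
                         when (v childOf? u) (label v) ∙ when (u childOf? v) (label u)
  weight-term v u with adj G u v in eq
  ... | false = begin
    ε      ≈⟨ identityʳ ε ⟨
    ε ∙ ε  ≡⟨ ≡.cong₂ _∙_ (when-no (v childOf? u) (non-edge ∘ Adj-sym G ∘ child-adj))
                          (when-no (u childOf? v) (non-edge ∘ child-adj)) ⟨
    when (v childOf? u) (label v) ∙ when (u childOf? v) (label u) ∎
    where
    non-edge : ¬ Adj G u v
    non-edge = ≡.subst T eq
  ... | true with parent-edge {u} {v} (≡.subst T (≡.sym eq) tt)
  ...   | inj₁ vu = begin
    edgeLabel u v  ≡⟨ edgeLabel-parent vu ⟩
    label v        ≈⟨ identityʳ (label v) ⟨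
    label v ∙ ε    ≡⟨ ≡.cong₂ _∙_ (when-yes (v childOf? u) vu) (when-no (u childOf? v) (child-asym vu)) ⟨
    when (v childOf? u) (label v) ∙ when (u childOf? v) (label u) ∎
  ...   | inj₂ uv = begin
    edgeLabel u v  ≡⟨ edgeLabel-child uv ⟩
    label u        ≈⟨ identityˡ (label u) ⟨
    ε ∙ label u    ≡⟨ ≡.cong₂ _∙_ (when-no (v childOf? u) (child-asym uv)) (when-yes (u childOf? v) uv) ⟨
    when (v childOf? u) (label v) ∙ when (u childOf? v) (label u) ∎

  weight≈parentSum∙childSum : ∀ v → weight A G edgeLabel v ≈ parentSum v ∙ childSum v
  weight≈parentSum∙childSum v = begin
    weight A G edgeLabel v                               ≡⟨ weight≡sum A G edgeLabel v ⟩
    sum (λ u → if adj G u v then edgeLabel u v else ε)  ≈⟨ sum-cong-≋ (weight-term v) ⟩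
    sum (λ u → when (v childOf? u) (label v) ∙ when (u childOf? v) (label u))
      ≈⟨ ∑-distrib-+ (λ u → when (v childOf? u) (label v)) (λ u → when (u childOf? v) (label u)) ⟩
    parentSum v ∙ childSum v                             ∎

  weight-root : weight A G edgeLabel r ≈ childSum r
  weight-root = trans (weight≈parentSum∙childSum r) (trans (∙-congʳ (sum-zero _ no-parent)) (identityˡ _))
    where
    no-parent : ∀ u → when (r childOf? u) (label r) ≈ ε
    no-parent u = reflexive (when-no (r childOf? u) λ (r≢r , _) → r≢r ≡.refl)

  weight-nonroot : ∀ {v} → v ≢ r → weight A G edgeLabel v ≈ label v ∙ childSum v
  weight-nonroot {v} v≢r =
    trans (weight≈parentSum∙childSum v) (∙-congʳ (trans (sum-single _ (parent v) only-parent) at-parent))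
    where
    only-parent : ∀ u → u ≢ parent v → when (v childOf? u) (label v) ≈ ε
    only-parent u u≢pv = reflexive (when-no (v childOf? u) λ (_ , pv≡u) → u≢pv (≡.sym pv≡u))

    at-parent : when (v childOf? parent v) (label v) ≈ label v
    at-parent = reflexive (when-yes (v childOf? parent v) (v≢r , ≡.refl))

module Construction (A : AbelianGroup 0ℓ 0ℓ) (D : DecidableAtLeast4 A)
  {n} {G : SimpleGraph n} {r} (R : RootedTree G r) (E : RootEdge R) where

  open AbelianGroup A
  open DecidableAtLeast4 D
  open RootedTree R
  open RootEdge E
  open ChildLabels A D
  open Sums commutativeMonoid
  open import Algebra.Properties.CommutativeMonoid.Sum commutativeMonoid using (sum; ∑-distrib-+; sum-cong-≋)
  open import Algebra.Properties.Monoid.Mult monoid using () renaming (_×_ to _·_)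
  open import Relation.Binary.Reasoning.Setoid setoid

  Carrier⁺ : Set
  Carrier⁺ = Σ Carrier (_≉ ε)

  e⁺ : Carrier⁺
  e⁺ = Product.map₂ proj₁ (avoid3 ε ε ε)

  _OrdinaryChildOf_ : Fin n → Fin n → Set
  u OrdinaryChildOf w = u ChildOf w × u ≢ c₀

  _ordinaryChildOf?_ : ∀ u w → Dec (u OrdinaryChildOf w)
  u ordinaryChildOf? w = (u childOf? w) ×-dec ¬? (u ≟ᶠ c₀)

  hasChildren? : ∀ w → Dec (∃ (_OrdinaryChildOf w))
  hasChildren? w = any? (_ordinaryChildOf? w)

  special : Fin n → Fin n
  special w with hasChildren? w
  ... | yes (u , _) = u
  ... | no  _       = w

  special-child : ∀ {w} → ∃ (_OrdinaryChildOf w) → special w OrdinaryChildOf w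
  special-child {w} children with hasChildren? w
  ... | yes (_ , u-child) = u-child
  ... | no  childless     = contradiction children childless

  #others : Fin n → ℕ
  #others w = count (λ u → (u ordinaryChildOf? w) ×-dec ¬? (u ≟ᶠ special w))

  record State : Set where
    field
      upLabel      : Carrier⁺
      parentWeight : Carrier

  module _ (w : Fin n) (s : State) where
    open State s

    private
      choice : ∃₂ (GoodChildLabels (proj₁ upLabel) parentWeight (#others w))
      choice = ∃-goodChildLabels (proj₂ upLabel) parentWeight (#others w)

    g x : Carrier
    g = proj₁ choice
    x = proj₁ (proj₂ choice)

    good : GoodChildLabels (proj₁ upLabel) parentWeight (#others w) g x
    good = proj₂ (proj₂ choice)

    plannedWeight : Carrier
    plannedWeight = proj₁ upLabel ∙ when (hasChildren? w) (x ∙ #others w · g)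

    childLabel : Fin n → Carrier⁺
    childLabel u with u ≟ᶠ c₀ | u ≟ᶠ special w
    ... | yes _ | _     = e⁺
    ... | no  _ | yes _ = x , GoodChildLabels.x≉ε good
    ... | no  _ | no  _ = g , GoodChildLabels.g≉ε good

    childState : Fin n → State
    childState u = record { upLabel = childLabel u ; parentWeight = plannedWeight }

  rootState : State
  rootState = record { upLabel = e⁺ ; parentWeight = proj₁ e⁺ }

  stateWithin : ℕ → Fin n → State
  stateWithin zero    _ = rootState
  stateWithin (suc j) u = childState (parent u) (stateWithin j (parent u)) u

  state : Fin n → State
  state u = stateWithin (depth u) u

  state-root : state r ≡ rootState
  state-root = ≡.cong (λ j → stateWithin j r) depth-root

  state-child : ∀ {u} → u ≢ r → state u ≡ childState (parent u) (state (parent u)) u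
  state-child {u} u≢r = ≡.cong (λ j → stateWithin j u) (depth-parent u≢r)

  label : Fin n → Carrier
  label u = proj₁ (State.upLabel (state u))

  label≉ε : ∀ u → label u ≉ ε
  label≉ε u = proj₂ (State.upLabel (state u))

  label-child : ∀ {u w} → u ChildOf w → label u ≡ proj₁ (childLabel w (state w) u)
  label-child {u} (u≢r , ≡.refl) = ≡.cong (proj₁ ∘ State.upLabel) (state-child u≢r)

  childLabel-c₀ : ∀ w s → childLabel w s c₀ ≡ e⁺
  childLabel-c₀ w s with c₀ ≟ᶠ c₀
  ... | yes _    = ≡.refl
  ... | no c₀≢c₀ = contradiction ≡.refl c₀≢c₀

  childLabel-special : ∀ w s {u} → u ≢ c₀ → u ≡ special w → proj₁ (childLabel w s u) ≡ x w s
  childLabel-special w s {u} u≢c₀ u≡sw with u ≟ᶠ c₀ | u ≟ᶠ special w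
  ... | yes u≡c₀ | _        = contradiction u≡c₀ u≢c₀
  ... | no _     | yes _    = ≡.refl
  ... | no _     | no u≢sw = contradiction u≡sw u≢sw

  childLabel-other : ∀ w s {u} → u ≢ c₀ → u ≢ special w → proj₁ (childLabel w s u) ≡ g w s
  childLabel-other w s {u} u≢c₀ u≢sw with u ≟ᶠ c₀ | u ≟ᶠ special w
  ... | yes u≡c₀ | _        = contradiction u≡c₀ u≢c₀
  ... | no _     | yes u≡sw = contradiction u≡sw u≢sw
  ... | no _     | no _     = ≡.refl

  ordinarySum : Fin n → Carrier
  ordinarySum w = sum (λ u → when (u ordinaryChildOf? w) (label u))

  ordinarySum-childless : ∀ {w} → ¬ ∃ (_OrdinaryChildOf w) → ordinarySum w ≈ ε
  ordinarySum-childless {w} childless =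
    sum-zero _ λ u → reflexive (when-no (u ordinaryChildOf? w) λ u-child → childless (u , u-child))

  ordinarySum-children : ∀ {w} → ∃ (_OrdinaryChildOf w) →
                         ordinarySum w ≈ x w (state w) ∙ #others w · g w (state w)
  ordinarySum-children {w} children = begin
    ordinarySum w
      ≈⟨ sum-cong-≋ (λ u → when-split (u ordinaryChildOf? w) (u ≟ᶠ special w)) ⟩
    sum (λ u → when (IsSpecial? u) (label u) ∙ when (IsOther? u) (label u))
      ≈⟨ ∑-distrib-+ (λ u → when (IsSpecial? u) (label u)) (λ u → when (IsOther? u) (label u)) ⟩
    sum (λ u → when (IsSpecial? u) (label u)) ∙ sum (λ u → when (IsOther? u) (label u))
      ≈⟨ ∙-cong (sum-single _ (special w) off-special)
                (sum-cong-≋ λ u → when-congʳ (IsOther? u) (reflexive ∘ other-label u)) ⟩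
    when (IsSpecial? (special w)) (label (special w)) ∙ sum (λ u → when (IsOther? u) (g w (state w)))
      ≈⟨ ∙-cong (reflexive (≡.trans (when-yes (IsSpecial? (special w)) (special-child children , ≡.refl)) special-label))
                (sum-when-count IsOther? (g w (state w))) ⟩
    x w (state w) ∙ #others w · g w (state w) ∎
    where
    IsSpecial? : ∀ u → Dec (u OrdinaryChildOf w × u ≡ special w)
    IsSpecial? u = (u ordinaryChildOf? w) ×-dec (u ≟ᶠ special w)

    IsOther? : ∀ u → Dec (u OrdinaryChildOf w × u ≢ special w)
    IsOther? u = (u ordinaryChildOf? w) ×-dec ¬? (u ≟ᶠ special w)

    off-special : ∀ u → u ≢ special w → when (IsSpecial? u) (label u) ≈ ε
    off-special u u≢sw = reflexive (when-no (IsSpecial? u) (u≢sw ∘ proj₂))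

    special-label : label (special w) ≡ x w (state w)
    special-label = let child , ≢c₀ = special-child children
                    in ≡.trans (label-child child) (childLabel-special w (state w) ≢c₀ ≡.refl)

    other-label : ∀ u → u OrdinaryChildOf w × u ≢ special w → label u ≡ g w (state w)
    other-label u ((child , ≢c₀) , ≢sw) = ≡.trans (label-child child) (childLabel-other w (state w) ≢c₀ ≢sw)

  ordinarySum≈planned : ∀ w → ordinarySum w ≈ when (hasChildren? w) (x w (state w) ∙ #others w · g w (state w))
  ordinarySum≈planned w = by-cases (hasChildren? w)
    where
    by-cases : Dec (∃ (_OrdinaryChildOf w)) →
               ordinarySum w ≈ when (hasChildren? w) (x w (state w) ∙ #others w · g w (state w))
    by-cases (yes children)  =
      trans (ordinarySum-children children) (reflexive (≡.sym (when-yes (hasChildren? w) children)))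
    by-cases (no  childless) =
      trans (ordinarySum-childless childless) (reflexive (≡.sym (when-no (hasChildren? w) childless)))

  open TreeWeights A R label public using (edgeLabel)
  open TreeWeights A R label hiding (edgeLabel)

  isC₀? : ∀ w u → Dec (u ChildOf w × u ≡ c₀)
  isC₀? w u = (u childOf? w) ×-dec (u ≟ᶠ c₀)

  childSum≈c₀Term∙ordinarySum : ∀ w → childSum w ≈ when (isC₀? w c₀) (label c₀) ∙ ordinarySum w
  childSum≈c₀Term∙ordinarySum w = begin
    childSum w
      ≈⟨ sum-cong-≋ (λ u → when-split (u childOf? w) (u ≟ᶠ c₀)) ⟩
    sum (λ u → when (isC₀? w u) (label u) ∙ when (u ordinaryChildOf? w) (label u))
      ≈⟨ ∑-distrib-+ (λ u → when (isC₀? w u) (label u)) (λ u → when (u ordinaryChildOf? w) (label u)) ⟩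
    sum (λ u → when (isC₀? w u) (label u)) ∙ ordinarySum w
      ≈⟨ ∙-congʳ (sum-single _ c₀ λ u u≢c₀ → reflexive (when-no (isC₀? w u) (u≢c₀ ∘ proj₂))) ⟩
    when (isC₀? w c₀) (label c₀) ∙ ordinarySum w ∎

  label-root : label r ≡ proj₁ e⁺
  label-root = ≡.cong (proj₁ ∘ State.upLabel) state-root

  label-c₀ : label c₀ ≡ proj₁ e⁺
  label-c₀ = ≡.trans (label-child c₀-child) (≡.cong proj₁ (childLabel-c₀ r (state r)))

  childSum-root : childSum r ≈ label r ∙ ordinarySum r
  childSum-root = trans (childSum≈c₀Term∙ordinarySum r) (∙-congʳ (reflexive c₀Term≡label-root))
    where
    c₀Term≡label-root : when (isC₀? r c₀) (label c₀) ≡ label r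
    c₀Term≡label-root = ≡.trans (when-yes (isC₀? r c₀) (c₀-child , ≡.refl)) (≡.trans label-c₀ (≡.sym label-root))

  childSum-nonroot : ∀ {w} → w ≢ r → childSum w ≈ ordinarySum w
  childSum-nonroot {w} w≢r =
    trans (childSum≈c₀Term∙ordinarySum w)
          (trans (∙-congʳ (reflexive (when-no (isC₀? w c₀) c₀-not-child))) (identityˡ _))
    where
    c₀-not-child : ¬ (c₀ ChildOf w × c₀ ≡ c₀)
    c₀-not-child ((_ , pc₀≡w) , _) = w≢r (≡.trans (≡.sym pc₀≡w) (proj₂ c₀-child))

  weight≈label∙ordinarySum : ∀ w → weight A G edgeLabel w ≈ label w ∙ ordinarySum w
  weight≈label∙ordinarySum w with w ≟ᶠ r
  ... | yes ≡.refl = trans weight-root childSum-root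
  ... | no  w≢r    = trans (weight-nonroot w≢r) (∙-congˡ (childSum-nonroot w≢r))

  weight≈plannedWeight : ∀ w → weight A G edgeLabel w ≈ plannedWeight w (state w)
  weight≈plannedWeight w = trans (weight≈label∙ordinarySum w) (∙-congˡ (ordinarySum≈planned w))

  plannedWeight-children : ∀ {w} s → ∃ (_OrdinaryChildOf w) →
                       plannedWeight w s ≡ proj₁ (State.upLabel s) ∙ (x w s ∙ #others w · g w s)
  plannedWeight-children {w} s children = ≡.cong (proj₁ (State.upLabel s) ∙_) (when-yes (hasChildren? w) children)

  plannedWeight≉parentWeight : ∀ {w} s → ∃ (_OrdinaryChildOf w) → plannedWeight w s ≉ State.parentWeight s
  plannedWeight≉parentWeight {w} s children eq =
    GoodChildLabels.weight≉b (good w s) (trans (reflexive (≡.sym (plannedWeight-children s children))) eq)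

  plannedWeight≉childLabel : ∀ {w u} s → u OrdinaryChildOf w → plannedWeight w s ≉ proj₁ (childLabel w s u)
  plannedWeight≉childLabel {w} {u} s (child , u≢c₀) eq = by-cases (u ≟ᶠ special w)
    where
    s≈label : plannedWeight w s ≈ proj₁ (childLabel w s u) →
              proj₁ (State.upLabel s) ∙ (x w s ∙ #others w · g w s) ≈ proj₁ (childLabel w s u)
    s≈label = trans (reflexive (≡.sym (plannedWeight-children s (u , child , u≢c₀))))

    by-cases : Dec (u ≡ special w) → ⊥
    by-cases (yes u≡sw) = GoodChildLabels.weight≉x (good w s)
                            (trans (s≈label eq) (reflexive (childLabel-special w s u≢c₀ u≡sw)))
    by-cases (no u≢sw)  = GoodChildLabels.weight≉g (good w s)
                            (trans (s≈label eq) (reflexive (childLabel-other w s u≢c₀ u≢sw)))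

  weight-childless : ∀ {u} → ¬ ∃ (_OrdinaryChildOf u) → weight A G edgeLabel u ≈ label u
  weight-childless {u} childless = trans (weight≈plannedWeight u)
    (trans (∙-congˡ (reflexive (when-no (hasChildren? u) childless))) (identityʳ (label u)))

  weight-root≉e : ¬ ∃ (_OrdinaryChildOf c₀) → weight A G edgeLabel r ≉ proj₁ e⁺
  weight-root≉e c₀-childless eq = plannedWeight≉parentWeight (state r) root-children
    (trans (sym (weight≈plannedWeight r)) (trans eq (reflexive (≡.sym (≡.cong State.parentWeight state-root)))))
    where
    c₀-not-own-child : ∀ {v} → v ChildOf c₀ → v ≢ c₀
    c₀-not-own-child vc₀ ≡.refl = proj₁ c₀-child (≡.trans (≡.sym (proj₂ vc₀)) (proj₂ c₀-child))

    root-children : ∃ (_OrdinaryChildOf r)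
    root-children =
      [ id , (λ (v , vc₀) → contradiction (v , vc₀ , c₀-not-own-child vc₀) c₀-childless) ]′ beyond-edge

  child-weight-differs : ∀ {u w} → u ChildOf w → weight A G edgeLabel u ≉ weight A G edgeLabel w
  child-weight-differs {u} {w} uw@(u≢r , ≡.refl) with hasChildren? u | u ≟ᶠ c₀
  ... | yes children | _ = λ eq → plannedWeight≉parentWeight (state u) children (begin
    plannedWeight u (state u)   ≈⟨ weight≈plannedWeight u ⟨
    weight A G edgeLabel u  ≈⟨ eq ⟩
    weight A G edgeLabel w  ≈⟨ weight≈plannedWeight w ⟩
    plannedWeight w (state w)   ≡⟨ ≡.cong State.parentWeight (state-child u≢r) ⟨
    State.parentWeight (state u) ∎)
  ... | no childless | no u≢c₀ = λ eq → plannedWeight≉childLabel (state w) (uw , u≢c₀) (begin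
    plannedWeight w (state w)            ≈⟨ weight≈plannedWeight w ⟨
    weight A G edgeLabel w           ≈⟨ eq ⟨
    weight A G edgeLabel u           ≈⟨ weight-childless childless ⟩
    label u                          ≡⟨ label-child uw ⟩
    proj₁ (childLabel w (state w) u) ∎)
  ... | no childless | yes ≡.refl = λ eq → weight-root≉e childless (begin
    weight A G edgeLabel r   ≡⟨ ≡.cong (weight A G edgeLabel) (proj₂ c₀-child) ⟨
    weight A G edgeLabel w   ≈⟨ eq ⟨
    weight A G edgeLabel c₀  ≈⟨ weight-childless childless ⟩
    label c₀                 ≡⟨ label-c₀ ⟩
    proj₁ e⁺                 ∎)

  edgeLabel≉ε : ∀ u v → edgeLabel u v ≉ ε
  edgeLabel≉ε u v with u childOf? v
  ... | yes _ = label≉ε u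
  ... | no  _ = label≉ε v

  goodLabelling : GoodLabelling A G edgeLabel
  goodLabelling =
      (λ _ _ a → reflexive (edgeLabel-sym a))
    , (λ u v _ → edgeLabel≉ε u v)
    , λ _ _ a → [ (λ vu → child-weight-differs vu ∘ sym) , child-weight-differs ]′ (parent-edge a)

tree-goodLabelling : (A : AbelianGroup 0ℓ 0ℓ) → DecidableAtLeast4 A →
                     ∀ {n} (G : SimpleGraph n) → 3 ≤ n → IsTree G →
                     Σ (Fin n → Fin n → AbelianGroup.Carrier A) (GoodLabelling A G)
tree-goodLabelling A D {suc m} G 3≤n tree = edgeLabel , goodLabelling
  where
  R : RootedTree G zero
  R = tree⇒rootedTree tree zero

  open Construction A D R (rootEdge (proj₁ tree) R 3≤n)

corollary4 : ∀ (n : ℕ) (T : SimpleGraph n) → 3 ≤ n → IsTree T → NZGroupSumChromatic≤ T 4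
corollary4 n T 3≤n tree = 4 , s≤s z≤n , ≤-refl , λ A order →
  tree-goodLabelling A (enumerated⇒decidableAtLeast4 A order ≤-refl) T 3≤n tree
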